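{- Let $p\geqslant 1$, let $n_0,\dots,n_{p-1}>1$ be natural numbers and let $t_0,\dots,t_{p-1}$ and $x$ be positive rational numbers. Let $n$ be the least common multiple of $n_0,\dots,n_{p-1}$, let $d_{i,j}$ be the greatest common divisor of $n_i$ and $n_j$ for $i\neq j$, let $c_0,\dots,c_{p-1}$ be integers with $\sum_{i<p}c_i(n/n_i)=1$, and let $\beta=\prod_{i<p}t_i^{c_i(n/n_i)}$. Then $$\bigwedge_{i<p}\Re_{n_i}(x\cdot t_i)\iff \Re_n(x\cdot\beta)\wedge\bigwedge_{i\neq j}\Re_{d_{i,j}}(t_i\cdot t_j^{ -1}).$$
   Context: For a natural number $m\geqslant 1$ and $y\in\mathbb{Q}^+$, $\Re_m(y)$ means that there exists $z\in\mathbb{Q}^+$ with $y=z^m$ (so $\Re_1$ holds of every positive rational). -}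

module Defs where

open import Data.Nat as ℕ using (ℕ; zero; suc)
open import Data.Nat.LCM using (lcm)
open import Data.Integer as ℤ using (ℤ; +_; -[1+_])
open import Data.Fin using (Fin; zero; suc)
open import Data.Rational using (ℚ; _*_; 1ℚ; 1/_; NonZero; Positive)
open import Data.Product using (Σ; _×_)
open import Relation.Binary.PropositionalEquality using (_≡_)

_^ℕ_ : ℚ → ℕ → ℚ
q ^ℕ zero  = 1ℚ
q ^ℕ suc k = q * (q ^ℕ k)

_^ℤ_ : (q : ℚ) → .{{NonZero q}} → ℤ → ℚ
q ^ℤ (+ k)     = q ^ℕ k
q ^ℤ -[1+ k ]  = (1/ q) ^ℕ suc k

Re : ℕ → ℚ → Set
Re m y = Σ ℚ λ z → Positive z × (y ≡ z ^ℕ m)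

lcmF : ∀ {p} → (Fin p → ℕ) → ℕ
lcmF {zero}  f = 1
lcmF {suc p} f = lcm (f zero) (lcmF (λ i → f (suc i)))

sumℤ : ∀ {p} → (Fin p → ℤ) → ℤ
sumℤ {zero}  f = + 0
sumℤ {suc p} f = f zero ℤ.+ sumℤ (λ i → f (suc i))

prodℚ : ∀ {p} → (Fin p → ℚ) → ℚ
prodℚ {zero}  f = 1ℚ
prodℚ {suc p} f = f zero * prodℚ (λ i → f (suc i))

-- Write the positive rationals additively, so that ℜ_m(y) says that y lies in the subgroup mℚ⁺. With
-- m_i = n/n_i and e_i = c_i m_i we have Σ e_i = 1, hence every g equals Σ e_i g; in particular
-- x + β = Σ e_i (x + t_i), and e_i (x + t_i) ∈ m_i n_i ℚ⁺ = nℚ⁺ when x + t_i ∈ n_i ℚ⁺. Conversely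
-- x + t_i = (x + β) + Σ_j e_j (t_i − t_j) with nℚ⁺ ⊆ n_i ℚ⁺ and e_j (t_i − t_j) ∈ m_j d_ij ℚ⁺ ⊆ n_i ℚ⁺,
-- because lcm(n_i, n_j) ∣ n gives n_i n_j ∣ d_ij n = d_ij m_j n_j. The pairwise conditions hold since
-- t_i − t_j = (x + t_i) − (x + t_j). Nothing beyond being an abelian group is used of ℚ⁺.
module Submission where

open import Defs
open import Data.Nat as ℕ using (ℕ; zero; suc; _<_; _≤_; z≤n; s≤s; >-nonZero; _/_)
open import Data.Nat.GCD using (gcd; gcd[m,n]∣m; gcd[m,n]∣n)
open import Data.Nat.LCM using (lcm; m∣lcm[m,n]; n∣lcm[m,n]; lcm-least; gcd*lcm)
open import Data.Nat.Divisibility using (_∣_; divides; ∣-trans; *-monoʳ-∣; *-cancelʳ-∣; module ∣-Reasoning)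
open import Data.Nat.DivMod using (m/n*n≡m)
open import Data.Nat.Properties using (<-trans)
import Data.Nat.Properties as ℕ
open import Data.Integer as ℤ using (ℤ; +_; -[1+_]; _⊖_)
import Data.Integer.Properties as ℤ
open import Data.Fin using (Fin; zero; suc; _≟_)
open import Data.Rational using (ℚ; _*_; _÷_; 1ℚ; 1/_; Positive)
open import Data.Rational.Properties
  using (pos⇒nonZero; pos*pos⇒pos; 1/pos⇒pos; *-assoc; *-comm; *-identityˡ; *-identityʳ; *-inverseˡ; *-inverseʳ)
open import Data.Product using (Σ; _,_; proj₁; proj₂)
open import Function.Bundles using (_⇔_; mk⇔; Equivalence)
open import Relation.Binary.PropositionalEquality using (_≡_; _≢_; cong)
import Relation.Binary.PropositionalEquality as ≡
open import Relation.Nullary using (yes; no)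
open import Algebra.Bundles using (AbelianGroup)
open import Level using (0ℓ; _⊔_)

f[i]∣lcmF[f] : ∀ {p} (f : Fin p → ℕ) i → f i ∣ lcmF f
f[i]∣lcmF[f] {suc p} f zero    = m∣lcm[m,n] (f zero) _
f[i]∣lcmF[f] {suc p} f (suc i) = ∣-trans (f[i]∣lcmF[f] (λ k → f (suc k)) i) (n∣lcm[m,n] (f zero) _)

a∣N⇒a∣m*gcd[a,b] : ∀ {a b N} m .{{_ : ℕ.NonZero b}} → a ∣ N → m ℕ.* b ≡ N → a ∣ m ℕ.* gcd a b
a∣N⇒a∣m*gcd[a,b] {a} {b} {N} m a∣N m*b≡N = *-cancelʳ-∣ b (begin
  a ℕ.* b                ≡⟨ gcd*lcm a b ⟨
  gcd a b ℕ.* lcm a b    ∣⟨ *-monoʳ-∣ (gcd a b) (lcm-least a∣N (divides m (≡.sym m*b≡N))) ⟩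
  gcd a b ℕ.* N          ≡⟨ cong (gcd a b ℕ.*_) m*b≡N ⟨
  gcd a b ℕ.* (m ℕ.* b)  ≡⟨ ℕ.*-assoc (gcd a b) m b ⟨
  gcd a b ℕ.* m ℕ.* b    ≡⟨ cong (ℕ._* b) (ℕ.*-comm (gcd a b) m) ⟩
  m ℕ.* gcd a b ℕ.* b    ∎)
  where open ∣-Reasoning

module Multiples {c ℓ} (G : AbelianGroup c ℓ) where

  open AbelianGroup G
    renaming (_∙_ to _+_; ε to 0#; _⁻¹ to -_; ∙-cong to +-cong; ∙-congˡ to +-congˡ; ∙-congʳ to +-congʳ;
              identityˡ to +-identityˡ; identityʳ to +-identityʳ; inverseʳ to -‿inverseʳ; comm to +-comm)
  open import Algebra.Properties.AbelianGroup G using (ε⁻¹≈ε; ⁻¹-∙-comm)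
  open import Algebra.Properties.CommutativeSemigroup commutativeSemigroup using (interchange)
  open import Algebra.Properties.CommutativeMonoid.Mult commutativeMonoid public
    using (_×_; ×-congʳ; ×-homo-1; ×-homo-+; ×-assocˡ; ×-distrib-+)
  open import Algebra.Properties.CommutativeMonoid.Sum commutativeMonoid public
    using (sum; sum-cong-≋; sum-replicate; sum-replicate-zero; ∑-distrib-+)
  open import Relation.Binary.Reasoning.Setoid setoid

  ×-zeroʳ : ∀ n → n × 0# ≈ 0#
  ×-zeroʳ n = trans (sym (sum-replicate n)) (sum-replicate-zero n)

  ×-homo-⁻¹ : ∀ n x → n × (- x) ≈ - (n × x)
  ×-homo-⁻¹ zero    x = sym ε⁻¹≈ε
  ×-homo-⁻¹ (suc n) x = trans (+-congˡ (×-homo-⁻¹ n x)) (⁻¹-∙-comm x (n × x))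

  infixr 8 _×ℤ_

  _×ℤ_ : ℤ → Carrier → Carrier
  (+ n)    ×ℤ x = n × x
  -[1+ n ] ×ℤ x = suc n × (- x)

  ×ℤ-congʳ : ∀ k {x y} → x ≈ y → k ×ℤ x ≈ k ×ℤ y
  ×ℤ-congʳ (+ n)      x≈y = ×-congʳ n x≈y
  ×ℤ-congʳ -[1+ n ]   x≈y = ×-congʳ (suc n) (⁻¹-cong x≈y)

  ×ℤ-congˡ : ∀ {k l} x → k ≡ l → k ×ℤ x ≈ l ×ℤ x
  ×ℤ-congˡ x k≡l = reflexive (cong (_×ℤ x) k≡l)

  ⊖-×ℤ : ∀ m n x → (m ⊖ n) ×ℤ x ≈ m × x - n × x
  ⊖-×ℤ m       zero    x = trans (sym (+-identityʳ _)) (+-congˡ (sym ε⁻¹≈ε))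
  ⊖-×ℤ zero    (suc n) x = trans (×-homo-⁻¹ (suc n) x) (sym (+-identityˡ _))
  ⊖-×ℤ (suc m) (suc n) x = begin
    (suc m ⊖ suc n) ×ℤ x              ≈⟨ ×ℤ-congˡ x (ℤ.[1+m]⊖[1+n]≡m⊖n m n) ⟩
    (m ⊖ n) ×ℤ x                      ≈⟨ ⊖-×ℤ m n x ⟩
    m × x - n × x                     ≈⟨ +-identityˡ _ ⟨
    0# + (m × x - n × x)              ≈⟨ +-congʳ (-‿inverseʳ x) ⟨
    (x - x) + (m × x - n × x)         ≈⟨ interchange x (- x) (m × x) (- (n × x)) ⟩
    (x + m × x) + (- x - n × x)       ≈⟨ +-congˡ (⁻¹-∙-comm x (n × x)) ⟩
    suc m × x - suc n × x             ∎

  ×ℤ-homo-+ : ∀ x k l → (k ℤ.+ l) ×ℤ x ≈ k ×ℤ x + l ×ℤ x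
  ×ℤ-homo-+ x (+ m)    (+ n)    = ×-homo-+ x m n
  ×ℤ-homo-+ x (+ m)    -[1+ n ] = trans (⊖-×ℤ m (suc n) x) (+-congˡ (sym (×-homo-⁻¹ (suc n) x)))
  ×ℤ-homo-+ x -[1+ m ] (+ n)    =
    trans (⊖-×ℤ n (suc m) x) (trans (+-congˡ (sym (×-homo-⁻¹ (suc m) x))) (+-comm _ _))
  ×ℤ-homo-+ x -[1+ m ] -[1+ n ] =
    trans (×-congˡ (cong suc (≡.sym (ℕ.+-suc m n)))) (×-homo-+ (- x) (suc m) (suc n))
    where open import Algebra.Properties.Monoid.Mult monoid using (×-congˡ)

  ×ℤ-distrib-+ : ∀ k x y → k ×ℤ (x + y) ≈ k ×ℤ x + k ×ℤ y
  ×ℤ-distrib-+ (+ n)    x y = ×-distrib-+ x y n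
  ×ℤ-distrib-+ -[1+ n ] x y =
    trans (×-congʳ (suc n) (sym (⁻¹-∙-comm x y))) (×-distrib-+ (- x) (- y) (suc n))

  ×ℤ-zeroʳ : ∀ k → k ×ℤ 0# ≈ 0#
  ×ℤ-zeroʳ (+ n)    = ×-zeroʳ n
  ×ℤ-zeroʳ -[1+ n ] = trans (×-congʳ (suc n) ε⁻¹≈ε) (×-zeroʳ (suc n))

  *-×ℤ : ∀ k m x → (k ℤ.* + m) ×ℤ x ≈ k ×ℤ (m × x)
  *-×ℤ k zero    x = trans (×ℤ-congˡ x (ℤ.*-zeroʳ k)) (sym (×ℤ-zeroʳ k))
  *-×ℤ k (suc m) x = begin
    (k ℤ.* + suc m) ×ℤ x              ≈⟨ ×ℤ-congˡ x (ℤ.*-suc k (+ m)) ⟩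
    (k ℤ.+ k ℤ.* + m) ×ℤ x            ≈⟨ ×ℤ-homo-+ x k (k ℤ.* + m) ⟩
    k ×ℤ x + (k ℤ.* + m) ×ℤ x         ≈⟨ +-congˡ (*-×ℤ k m x) ⟩
    k ×ℤ x + k ×ℤ (m × x)             ≈⟨ ×ℤ-distrib-+ k x (m × x) ⟨
    k ×ℤ (suc m × x)                  ∎

  sumℤ-×ℤ : ∀ {p} (e : Fin p → ℤ) x → sumℤ e ×ℤ x ≈ sum (λ i → e i ×ℤ x)
  sumℤ-×ℤ {zero}  e x = refl
  sumℤ-×ℤ {suc p} e x = trans (×ℤ-homo-+ x (e zero) _) (+-congˡ (sumℤ-×ℤ (λ i → e (suc i)) x))

  sum-affine : ∀ {p} (e : Fin p → ℤ) → sumℤ e ≡ + 1 → ∀ y (t : Fin p → Carrier) →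
               sum (λ i → e i ×ℤ (y + t i)) ≈ y + sum (λ i → e i ×ℤ t i)
  sum-affine e Σe≡1 y t = begin
    sum (λ i → e i ×ℤ (y + t i))                       ≈⟨ sum-cong-≋ (λ i → ×ℤ-distrib-+ (e i) y (t i)) ⟩
    sum (λ i → e i ×ℤ y + e i ×ℤ t i)                  ≈⟨ ∑-distrib-+ (λ i → e i ×ℤ y) (λ i → e i ×ℤ t i) ⟩
    sum (λ i → e i ×ℤ y) + sum (λ i → e i ×ℤ t i)      ≈⟨ +-congʳ (sumℤ-×ℤ e y) ⟨
    sumℤ e ×ℤ y + sum (λ i → e i ×ℤ t i)               ≈⟨ +-congʳ (trans (×ℤ-congˡ y Σe≡1) (×-homo-1 y)) ⟩
    y + sum (λ i → e i ×ℤ t i)                         ∎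

  sum-×ℤ-inverseʳ : ∀ {p} (e : Fin p → ℤ) (t : Fin p → Carrier) →
                    sum (λ i → e i ×ℤ t i) + sum (λ i → e i ×ℤ (- t i)) ≈ 0#
  sum-×ℤ-inverseʳ {p} e t = begin
    sum (λ i → e i ×ℤ t i) + sum (λ i → e i ×ℤ (- t i))
      ≈⟨ ∑-distrib-+ (λ i → e i ×ℤ t i) (λ i → e i ×ℤ (- t i)) ⟨
    sum (λ i → e i ×ℤ t i + e i ×ℤ (- t i))
      ≈⟨ sum-cong-≋ (λ i → ×ℤ-distrib-+ (e i) (t i) (- t i)) ⟨
    sum (λ i → e i ×ℤ (t i - t i))
      ≈⟨ sum-cong-≋ (λ i → trans (×ℤ-congʳ (e i) (-‿inverseʳ (t i))) (×ℤ-zeroʳ (e i))) ⟩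
    sum {p} (λ _ → 0#)
      ≈⟨ sum-replicate-zero p ⟩
    0# ∎

  data Multiple (n : ℕ) (y : Carrier) : Set (c ⊔ ℓ) where
    multiple : ∀ z → y ≈ n × z → Multiple n y

  Multiple-resp-≈ : ∀ {n x y} → x ≈ y → Multiple n x → Multiple n y
  Multiple-resp-≈ x≈y (multiple z x≈nz) = multiple z (trans (sym x≈y) x≈nz)

  Multiple-0 : ∀ n → Multiple n 0#
  Multiple-0 n = multiple 0# (sym (×-zeroʳ n))

  Multiple-+ : ∀ {n x y} → Multiple n x → Multiple n y → Multiple n (x + y)
  Multiple-+ {n} (multiple u x≈nu) (multiple v y≈nv) =
    multiple (u + v) (trans (+-cong x≈nu y≈nv) (sym (×-distrib-+ u v n)))

  Multiple-⁻¹ : ∀ {n x} → Multiple n x → Multiple n (- x)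
  Multiple-⁻¹ {n} (multiple u x≈nu) = multiple (- u) (trans (⁻¹-cong x≈nu) (sym (×-homo-⁻¹ n u)))

  Multiple-× : ∀ {n x} m → Multiple n x → Multiple n (m × x)
  Multiple-× zero    _   = Multiple-0 _
  Multiple-× (suc m) n∣x = Multiple-+ n∣x (Multiple-× m n∣x)

  Multiple-×ℤ : ∀ {n x} k → Multiple n x → Multiple n (k ×ℤ x)
  Multiple-×ℤ (+ m)    n∣x = Multiple-× m n∣x
  Multiple-×ℤ -[1+ m ] n∣x = Multiple-× (suc m) (Multiple-⁻¹ n∣x)

  Multiple-sum : ∀ {n p} (f : Fin p → Carrier) → (∀ i → Multiple n (f i)) → Multiple n (sum f)
  Multiple-sum {p = zero}  f n∣f = Multiple-0 _
  Multiple-sum {p = suc p} f n∣f =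
    Multiple-+ (n∣f zero) (Multiple-sum (λ i → f (suc i)) (λ i → n∣f (suc i)))

  Multiple-∣ : ∀ {d n x} → d ∣ n → Multiple n x → Multiple d x
  Multiple-∣ {d} {n} {x} (divides q n≡q*d) (multiple z x≈nz) = multiple (q × z) (begin
    x                ≈⟨ x≈nz ⟩
    n × z            ≡⟨ cong (_× z) (≡.trans n≡q*d (ℕ.*-comm q d)) ⟩
    (d ℕ.* q) × z    ≈⟨ ×-assocˡ z d q ⟨
    d × q × z        ∎)

  Multiple-*-× : ∀ {d x} m → Multiple d x → Multiple (m ℕ.* d) (m × x)
  Multiple-*-× {d} m (multiple z x≈dz) = multiple z (trans (×-congʳ m x≈dz) (×-assocˡ z m d))

  Multiple-gcd : ∀ {a b} x y z → Multiple a (x + y) → Multiple b (x + z) → Multiple (gcd a b) (y - z)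
  Multiple-gcd {a} {b} x y z a∣x+y b∣x+z = Multiple-resp-≈ x+y-[x+z]≈y-z
    (Multiple-+ (Multiple-∣ (gcd[m,n]∣m a b) a∣x+y) (Multiple-⁻¹ (Multiple-∣ (gcd[m,n]∣n a b) b∣x+z)))
    where
    x+y-[x+z]≈y-z : (x + y) - (x + z) ≈ y - z
    x+y-[x+z]≈y-z = begin
      (x + y) - (x + z)        ≈⟨ +-congˡ (⁻¹-∙-comm x z) ⟨
      (x + y) + (- x - z)      ≈⟨ interchange x y (- x) (- z) ⟩
      (x - x) + (y - z)        ≈⟨ +-congʳ (-‿inverseʳ x) ⟩
      0# + (y - z)             ≈⟨ +-identityˡ (y - z) ⟩
      y - z                    ∎

  module _ {p} (n m : Fin p → ℕ) {N : ℕ} (m*n≡N : ∀ i → m i ℕ.* n i ≡ N)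
           (c : Fin p → ℤ) (Σcm≡1 : sumℤ (λ i → c i ℤ.* + m i) ≡ + 1)
           (x : Carrier) (t : Fin p → Carrier) where

    private
      e : Fin p → ℤ
      e i = c i ℤ.* + m i

      Multiple-e×ℤ : ∀ {d y} i → Multiple d y → Multiple (m i ℕ.* d) (e i ×ℤ y)
      Multiple-e×ℤ {y = y} i d∣y =
        Multiple-resp-≈ (sym (*-×ℤ (c i) (m i) y)) (Multiple-×ℤ (c i) (Multiple-*-× (m i) d∣y))

    β : Carrier
    β = sum (λ i → e i ×ℤ t i)

    all-Multiple⇒Multiple-lcm : (∀ i → Multiple (n i) (x + t i)) → Multiple N (x + β)
    all-Multiple⇒Multiple-lcm n∣x+t = Multiple-resp-≈ (sum-affine e Σcm≡1 x t) (Multiple-sum _ λ i →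
      ≡.subst (λ k → Multiple k (e i ×ℤ (x + t i))) (m*n≡N i) (Multiple-e×ℤ i (n∣x+t i)))

    Multiple-lcm⇒Multiple : (∀ j → ℕ.NonZero (n j)) → Multiple N (x + β) →
                         ∀ i → (∀ j → Multiple (gcd (n i) (n j)) (t i - t j)) → Multiple (n i) (x + t i)
    Multiple-lcm⇒Multiple n≢0 N∣x+β i gcd∣t-t = Multiple-resp-≈ x+t≈ (Multiple-+ (Multiple-∣ nᵢ∣N N∣x+β)
      (Multiple-sum _ λ j → Multiple-∣ (nᵢ∣mⱼ*gcd j) (Multiple-e×ℤ j (gcd∣t-t j))))
      where
      nᵢ∣N : n i ∣ N
      nᵢ∣N = divides (m i) (≡.sym (m*n≡N i))

      nᵢ∣mⱼ*gcd : ∀ j → n i ∣ m j ℕ.* gcd (n i) (n j)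
      nᵢ∣mⱼ*gcd j = a∣N⇒a∣m*gcd[a,b] (m j) {{n≢0 j}} nᵢ∣N (m*n≡N j)

      x+t≈ : (x + β) + sum (λ j → e j ×ℤ (t i - t j)) ≈ x + t i
      x+t≈ = begin
        (x + β) + sum (λ j → e j ×ℤ (t i - t j))               ≈⟨ +-congˡ (sum-affine e Σcm≡1 (t i) (λ j → - t j)) ⟩
        (x + β) + (t i + sum (λ j → e j ×ℤ (- t j)))           ≈⟨ interchange x β (t i) _ ⟩
        (x + t i) + (β + sum (λ j → e j ×ℤ (- t j)))           ≈⟨ +-congˡ (sum-×ℤ-inverseʳ e t) ⟩
        (x + t i) + 0#                                          ≈⟨ +-identityʳ (x + t i) ⟩
        x + t i                                                 ∎

module PositiveRationals where

  open import Relation.Binary.PropositionalEquality using (refl; sym; trans; cong₂)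

  Q⁺ : Set
  Q⁺ = Σ ℚ Positive

  Q⁺-abelianGroup : AbelianGroup 0ℓ 0ℓ
  Q⁺-abelianGroup = record
    { Carrier = Q⁺
    ; _≈_ = λ a b → proj₁ a ≡ proj₁ b
    ; _∙_ = λ (a , a>0) (b , b>0) → a * b , pos*pos⇒pos a {{a>0}} b {{b>0}}
    ; ε = 1ℚ , _
    ; _⁻¹ = λ (a , a>0) → (1/ a) {{pos⇒nonZero a {{a>0}}}} , 1/pos⇒pos a {{a>0}}
    ; isAbelianGroup = record
      { isGroup = record
        { isMonoid = record
          { isSemigroup = record
            { isMagma = record
              { isEquivalence = record { refl = refl ; sym = sym ; trans = trans }
              ; ∙-cong = cong₂ _*_ }
            ; assoc = λ a b c → *-assoc (proj₁ a) (proj₁ b) (proj₁ c) }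
          ; identity = (λ a → *-identityˡ (proj₁ a)) , (λ a → *-identityʳ (proj₁ a)) }
        ; inverse = (λ (a , a>0) → *-inverseˡ a {{pos⇒nonZero a {{a>0}}}})
                  , (λ (a , a>0) → *-inverseʳ a {{pos⇒nonZero a {{a>0}}}})
        ; ⁻¹-cong = λ { {a , _} {.a , _} refl → refl } }
      ; comm = λ a b → *-comm (proj₁ a) (proj₁ b) } }

  -- The group is written additively in Multiples: k × g is the k-th power of g.
  open Multiples Q⁺-abelianGroup
  open AbelianGroup Q⁺-abelianGroup using (_⁻¹)

  proj₁-× : ∀ k g → proj₁ (k × g) ≡ proj₁ g ^ℕ k
  proj₁-× zero    g = refl
  proj₁-× (suc k) g = cong (proj₁ g *_) (proj₁-× k g)

  proj₁-×ℤ : ∀ k g → proj₁ (k ×ℤ g) ≡ _^ℤ_ (proj₁ g) {{pos⇒nonZero (proj₁ g) {{proj₂ g}}}} k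
  proj₁-×ℤ (+ k)    g = proj₁-× k g
  proj₁-×ℤ -[1+ k ] g = proj₁-× (suc k) (g ⁻¹)

  proj₁-sum : ∀ {p} (f : Fin p → Q⁺) (g : Fin p → ℚ) → (∀ i → proj₁ (f i) ≡ g i) → proj₁ (sum f) ≡ prodℚ g
  proj₁-sum {zero}  f g f≡g = refl
  proj₁-sum {suc p} f g f≡g =
    cong₂ _*_ (f≡g zero) (proj₁-sum (λ i → f (suc i)) (λ i → g (suc i)) (λ i → f≡g (suc i)))

  Re⇔Multiple : ∀ m g → Re m (proj₁ g) ⇔ Multiple m g
  Re⇔Multiple m g = mk⇔ (λ (z , z>0 , g≡z^m) → multiple (z , z>0) (trans g≡z^m (sym (proj₁-× m (z , z>0)))))
                        (λ { (multiple (z , z>0) g≈m×z) → z , z>0 , trans g≈m×z (proj₁-× m (z , z>0)) })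

open PositiveRationals using (Q⁺; Q⁺-abelianGroup; proj₁-×ℤ; proj₁-sum; Re⇔Multiple)
open Multiples Q⁺-abelianGroup
  using (Multiple; Multiple-resp-≈; Multiple-0; Multiple-gcd; β; all-Multiple⇒Multiple-lcm; Multiple-lcm⇒Multiple)
open import Data.Product using (_×_)

mainTheorem17 : (p : ℕ) → 1 ≤ p →
    (n : Fin p → ℕ) → (n>1 : ∀ i → 1 < n i) →
    (t : Fin p → ℚ) → (tpos : ∀ i → Positive (t i)) →
    (x : ℚ) → Positive x →
    (c : Fin p → ℤ) →
    sumℤ (λ i → c i ℤ.* (+ ((lcmF n / n i) {{>-nonZero (<-trans (s≤s z≤n) (n>1 i))}}))) ≡ + 1 →
    ((∀ i → Re (n i) (x * t i))
      ⇔ (Re (lcmF n) (x * prodℚ (λ i → _^ℤ_ (t i) {{pos⇒nonZero (t i) {{tpos i}}}} (c i ℤ.* (+ ((lcmF n / n i) {{>-nonZero (<-trans (s≤s z≤n) (n>1 i))}})))))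
        × (∀ i j → i ≢ j → Re (gcd (n i) (n j)) ((t i ÷ t j) {{pos⇒nonZero (t j) {{tpos j}}}}))))
mainTheorem17 p _ n n>1 t tpos x x>0 c Σcm≡1 = mk⇔
  (λ n∣x+t → let n∣X+T = λ i → to (Re⇔Multiple (n i) (X + T i)) (n∣x+t i) in
    from Re[x*β]⇔Multiple (all-Multiple⇒Multiple-lcm n m m*n≡N c Σcm≡1 X T n∣X+T) ,
    λ i j _ → from (Re⇔Multiple (gcd (n i) (n j)) (T i - T j)) (Multiple-gcd X (T i) (T j) (n∣X+T i) (n∣X+T j)))
  (λ (N∣x*β , gcd∣t÷t) i → from (Re⇔Multiple (n i) (X + T i))
    (Multiple-lcm⇒Multiple n m m*n≡N c Σcm≡1 X T n≢0 (to Re[x*β]⇔Multiple N∣x*β) i (gcd∣T-T gcd∣t÷t i)))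
  where
  open AbelianGroup Q⁺-abelianGroup using (_-_) renaming (_∙_ to _+_)
  open Equivalence

  n≢0 : ∀ i → ℕ.NonZero (n i)
  n≢0 i = >-nonZero (<-trans (s≤s z≤n) (n>1 i))

  N : ℕ
  N = lcmF n

  m : Fin p → ℕ
  m i = (N / n i) {{n≢0 i}}

  m*n≡N : ∀ i → m i ℕ.* n i ≡ N
  m*n≡N i = m/n*n≡m {{n≢0 i}} (f[i]∣lcmF[f] n i)

  X : Q⁺
  X = x , x>0

  T : Fin p → Q⁺
  T i = t i , tpos i

  B : Q⁺
  B = β n m m*n≡N c Σcm≡1 X T

  x*β : ℚ
  x*β = x * prodℚ (λ i → _^ℤ_ (t i) {{pos⇒nonZero (t i) {{tpos i}}}} (c i ℤ.* + m i))

  x*β≡X+B : x*β ≡ proj₁ (X + B)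
  x*β≡X+B = cong (x *_) (≡.sym (proj₁-sum _ _ λ i → proj₁-×ℤ (c i ℤ.* + m i) (T i)))

  Re[x*β]⇔Multiple : Re N x*β ⇔ Multiple N (X + B)
  Re[x*β]⇔Multiple = mk⇔ (λ r → to (Re⇔Multiple N (X + B)) (≡.subst (Re N) x*β≡X+B r))
                         (λ r → ≡.subst (Re N) (≡.sym x*β≡X+B) (from (Re⇔Multiple N (X + B)) r))

  gcd∣T-T : (∀ i j → i ≢ j → Re (gcd (n i) (n j)) ((t i ÷ t j) {{pos⇒nonZero (t j) {{tpos j}}}})) →
            ∀ i j → Multiple (gcd (n i) (n j)) (T i - T j)
  gcd∣T-T gcd∣t÷t i j with i ≟ j
  ... | yes ≡.refl = Multiple-resp-≈ (≡.sym (*-inverseʳ (t i) {{pos⇒nonZero (t i) {{tpos i}}}})) (Multiple-0 _)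
  ... | no i≢j     = to (Re⇔Multiple _ (T i - T j)) (gcd∣t÷t i j i≢j)
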